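{- Let $(P,m,1_P,R)$ be a Rota–Baxter species of weight $\lambda$. (1) The graded algebra $\mathcal{F}(P)=\bigoplus_{n\ge0}P[\underline{n}]$ is a graded Rota–Baxter algebra of weight $\lambda$ with the operator $P_{\mathcal{F}}(x)=R_{\underline{m}}(x)$ for $x\in P[\underline{m}]$. (2) The graded algebra $\overline{\mathcal{F}}(P)=\bigoplus_{n\ge0}\mathrm{Coinv}(P[\underline{n}])$ is a graded Rota–Baxter algebra of weight $\lambda$ with the operator $P_{\overline{\mathcal{F}}}(\overline{x})=\overline{R_{\underline{m}}(x)}$ for $x\in P[\underline{m}]$.
   Context: $\mathbf{k}$ is a field of characteristic zero, $\lambda\in\mathbf{k}$. A species is a functor from finite sets with bijections to $\mathbf{k}$-vector spaces. A twisted algebra is a species with natural, associative, unital products $m_{X,Y}:P[X]\otimes P[Y]\to P[X\sqcup Y]$ (unit $1_P\in P[\emptyset]$). A Rota–Baxter species of weight $\lambda$ is a twisted algebra with a morphism of species $R:P\to P$ such that $m_{X,Y}(R_Xx\otimes R_Yy)=R_{X\sqcup Y}m_{X,Y}(R_Xx\otimes y+x\otimes R_Yy+\lambda x\otimes y)$ for all $x\in P[X]$, $y\in P[Y]$. Write $\underline{n}=\{1,\dots,n\}$, $\underline{0}=\emptyset$, and $\sigma_{m,n}:\underline{m}\sqcup\underline{n}\to\underline{m+n}$ for the bijection that is the identity on $\underline{m}$ and $i\mapsto i+m$ on $\underline{n}$. $\mathcal{F}(P)=\bigoplus_n P[\underline{n}]$ is a graded algebra with product $x\cdot y=P[\sigma_{m,n}](m_{\underline{m},\underline{n}}(x\otimes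 y))$ for $x\in P[\underline{m}]$, $y\in P[\underline{n}]$, and unit $1_P$. $\mathrm{Coinv}(P[\underline{n}])$ is the quotient of $P[\underline{n}]$ by the span of $x-P[\alpha](x)$, $\alpha\in\mathfrak{S}_n$; $\overline{\mathcal{F}}(P)=\bigoplus_n\mathrm{Coinv}(P[\underline{n}])$ is the quotient of $\mathcal{F}(P)$ by the ideal spanned by all such $x-P[\alpha](x)$, with the induced graded algebra structure; $\overline{x}$ denotes the class of $x$. A graded Rota–Baxter algebra of weight $\lambda$ is a graded algebra $A=\bigoplus_nA_n$ with a Rota–Baxter operator $Q$ of weight $\lambda$ (i.e. $Q(a)Q(b)=Q(Q(a)b+aQ(b)+\lambda ab)$) with $Q(A_n)\subseteq A_n$. -}

module Defs where

open import Level using (Level; 0ℓ; _⊔_) renaming (suc to lsuc)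
open import Data.Nat using (ℕ; zero; suc; _+_; _≟_)
open import Data.Fin using (Fin)
open import Data.Fin.Properties using (+↔⊎)
open import Data.Sum using (_⊎_; inj₁; inj₂; [_,_])
open import Data.Sum.Algebra using (⊎-assoc; ⊎-cong)
open import Data.Product using (Σ; Σ-syntax; _,_; _×_)
open import Data.List using (List; []; _∷_; _++_; map; concatMap)
open import Function.Bundles using (_↔_; Inverse; mk↔ₛ′)
open import Function.Properties.Inverse using (↔-refl; ↔-sym; ↔-trans)
open import Relation.Binary.PropositionalEquality using (_≡_; _≢_; refl; cong)
open import Relation.Nullary using (¬_; yes; no)
open import Algebra.Bundles using (CommutativeRing)
open import Algebra.Module.Bundles using (Module)

ℕ·1 : ∀ {c ℓ} (R : CommutativeRing c ℓ) → ℕ → CommutativeRing.Carrier R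
ℕ·1 R zero    = CommutativeRing.0# R
ℕ·1 R (suc n) = CommutativeRing._+_ R (CommutativeRing.1# R) (ℕ·1 R n)

record Field (c ℓ : Level) : Set (lsuc (c ⊔ ℓ)) where
  field
    commutativeRing : CommutativeRing c ℓ
  open CommutativeRing commutativeRing public
  field
    0≉1      : ¬ (0# ≈ 1#)
    inverse  : ∀ x → ¬ (x ≈ 0#) → Σ[ y ∈ Carrier ] (x * y ≈ 1#)
    charZero : ∀ n → ¬ (ℕ·1 commutativeRing (suc n) ≈ 0#)

record FinSet : Set₁ where
  constructor finSet
  field
    Elt  : Set
    card : ℕ
    enum : Elt ↔ Fin card
open FinSet public

record Bij (X Y : FinSet) : Set where
  constructor mkBij
  field
    bij : Elt X ↔ Elt Y
open Bij public

idᵇ : ∀ {X} → Bij X X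
idᵇ = mkBij ↔-refl

_∘ᵇ_ : ∀ {X Y Z} → Bij Y Z → Bij X Y → Bij X Z
g ∘ᵇ f = mkBij (↔-trans (bij f) (bij g))

-- the finite set n̲ = {1,…,n}, modelled by Fin n; 0̲ = ∅
n̲ : ℕ → FinSet
n̲ n = finSet (Fin n) n ↔-refl

∅ : FinSet
∅ = n̲ 0

_⊔ˢ_ : FinSet → FinSet → FinSet
X ⊔ˢ Y = finSet (Elt X ⊎ Elt Y) (card X + card Y)
                (↔-trans (⊎-cong (enum X) (enum Y)) (↔-sym +↔⊎))

_⊔ᵇ_ : ∀ {X X' Y Y'} → Bij X X' → Bij Y Y' → Bij (X ⊔ˢ Y) (X' ⊔ˢ Y')
f ⊔ᵇ g = mkBij (⊎-cong (bij f) (bij g))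

assocᵇ : ∀ X Y Z → Bij ((X ⊔ˢ Y) ⊔ˢ Z) (X ⊔ˢ (Y ⊔ˢ Z))
assocᵇ X Y Z = mkBij (⊎-assoc 0ℓ (Elt X) (Elt Y) (Elt Z))

unitˡᵇ : ∀ X → Bij (∅ ⊔ˢ X) X
unitˡᵇ X = mkBij (mk↔ₛ′ [ (λ ()) , (λ x → x) ] inj₂ (λ _ → refl) [ (λ ()) , (λ _ → refl) ])

unitʳᵇ : ∀ X → Bij (X ⊔ˢ ∅) X
unitʳᵇ X = mkBij (mk↔ₛ′ [ (λ x → x) , (λ ()) ] inj₁ (λ _ → refl) [ (λ _ → refl) , (λ ()) ])

-- σ_{m,n} : m̲ ⊔ n̲ → (m+n)̲ : identity on m̲, i ↦ i + m on n̲
σ : ∀ m n → Bij (n̲ m ⊔ˢ n̲ n) (n̲ (m + n))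
σ m n = mkBij (↔-sym +↔⊎)

module _ {c ℓ : Level} (K : Field c ℓ) where
  private
    module K = Field K
    CR = K.commutativeRing

  record Species (m ℓm : Level) : Set (lsuc (c ⊔ ℓ ⊔ m ⊔ ℓm)) where
    field
      obj  : FinSet → Module CR m ℓm
      mapˢ : ∀ {X Y} → Bij X Y → Module.Carrierᴹ (obj X) → Module.Carrierᴹ (obj Y)
    field
      mapˢ-cong : ∀ {X Y} (f : Bij X Y) {x y} → Module._≈ᴹ_ (obj X) x y
                  → Module._≈ᴹ_ (obj Y) (mapˢ f x) (mapˢ f y)
      mapˢ-+    : ∀ {X Y} (f : Bij X Y) x y
                  → Module._≈ᴹ_ (obj Y) (mapˢ f (Module._+ᴹ_ (obj X) x y))
                                        (Module._+ᴹ_ (obj Y) (mapˢ f x) (mapˢ f y))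
      mapˢ-*    : ∀ {X Y} (f : Bij X Y) (a : K.Carrier) x
                  → Module._≈ᴹ_ (obj Y) (mapˢ f (Module._*ₗ_ (obj X) a x))
                                        (Module._*ₗ_ (obj Y) a (mapˢ f x))
      mapˢ-resp : ∀ {X Y} (f g : Bij X Y) → (∀ e → Inverse.to (bij f) e ≡ Inverse.to (bij g) e)
                  → ∀ x → Module._≈ᴹ_ (obj Y) (mapˢ f x) (mapˢ g x)
      mapˢ-id   : ∀ {X} x → Module._≈ᴹ_ (obj X) (mapˢ (idᵇ {X}) x) x
      mapˢ-∘    : ∀ {X Y Z} (f : Bij X Y) (g : Bij Y Z) x
                  → Module._≈ᴹ_ (obj Z) (mapˢ (g ∘ᵇ f) x) (mapˢ g (mapˢ f x))

  module SpeciesNotation {m ℓm : Level} (P : Species m ℓm) where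
    V : FinSet → Set m
    V X = Module.Carrierᴹ (Species.obj P X)

    infix 4 _≈[_]_
    _≈[_]_ : ∀ {X} → V X → (Y : FinSet) → V X → Set ℓm
    _≈[_]_ {X} x _ y = Module._≈ᴹ_ (Species.obj P X) x y

  record TwistedAlgebra {m ℓm : Level} (P : Species m ℓm) : Set (lsuc (c ⊔ ℓ ⊔ m ⊔ ℓm)) where
    open Species P
    open SpeciesNotation P
    field
      -- m_{X,Y} : P[X] ⊗ P[Y] → P[X ⊔ Y], given as a bilinear map
      mul  : ∀ {X Y} → V X → V Y → V (X ⊔ˢ Y)
      unit : V ∅
    field
      mul-cong : ∀ {X Y} {x x' : V X} {y y' : V Y} → x ≈[ X ] x' → y ≈[ Y ] y'
                 → mul x y ≈[ X ⊔ˢ Y ] mul x' y'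
      mul-+ˡ   : ∀ {X Y} (x x' : V X) (y : V Y)
                 → mul (Module._+ᴹ_ (obj X) x x') y
                   ≈[ X ⊔ˢ Y ] Module._+ᴹ_ (obj (X ⊔ˢ Y)) (mul x y) (mul x' y)
      mul-+ʳ   : ∀ {X Y} (x : V X) (y y' : V Y)
                 → mul x (Module._+ᴹ_ (obj Y) y y')
                   ≈[ X ⊔ˢ Y ] Module._+ᴹ_ (obj (X ⊔ˢ Y)) (mul x y) (mul x y')
      mul-*ˡ   : ∀ {X Y} (a : K.Carrier) (x : V X) (y : V Y)
                 → mul (Module._*ₗ_ (obj X) a x) y ≈[ X ⊔ˢ Y ] Module._*ₗ_ (obj (X ⊔ˢ Y)) a (mul x y)
      mul-*ʳ   : ∀ {X Y} (a : K.Carrier) (x : V X) (y : V Y)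
                 → mul x (Module._*ₗ_ (obj Y) a y) ≈[ X ⊔ˢ Y ] Module._*ₗ_ (obj (X ⊔ˢ Y)) a (mul x y)
      mul-natural : ∀ {X X' Y Y'} (f : Bij X X') (g : Bij Y Y') (x : V X) (y : V Y)
                 → mapˢ (f ⊔ᵇ g) (mul x y) ≈[ X' ⊔ˢ Y' ] mul (mapˢ f x) (mapˢ g y)
      mul-assoc : ∀ {X Y Z} (x : V X) (y : V Y) (z : V Z)
                 → mapˢ (assocᵇ X Y Z) (mul (mul x y) z) ≈[ X ⊔ˢ (Y ⊔ˢ Z) ] mul x (mul y z)
      mul-unitˡ : ∀ {X} (x : V X) → mapˢ (unitˡᵇ X) (mul unit x) ≈[ X ] x
      mul-unitʳ : ∀ {X} (x : V X) → mapˢ (unitʳᵇ X) (mul x unit) ≈[ X ] x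

  record RotaBaxterSpecies (λ' : K.Carrier) (m ℓm : Level) : Set (lsuc (c ⊔ ℓ ⊔ m ⊔ ℓm)) where
    field
      species : Species m ℓm
      twisted : TwistedAlgebra species
    open Species species
    open TwistedAlgebra twisted
    open SpeciesNotation species
    field
      R       : ∀ X → V X → V X
      R-cong  : ∀ X {x y : V X} → x ≈[ X ] y → R X x ≈[ X ] R X y
      R-+     : ∀ X (x y : V X) → R X (Module._+ᴹ_ (obj X) x y) ≈[ X ] Module._+ᴹ_ (obj X) (R X x) (R X y)
      R-*     : ∀ X (a : K.Carrier) (x : V X) → R X (Module._*ₗ_ (obj X) a x) ≈[ X ] Module._*ₗ_ (obj X) a (R X x)
      R-natural : ∀ {X Y} (f : Bij X Y) (x : V X) → R Y (mapˢ f x) ≈[ Y ] mapˢ f (R X x)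
      R-RB    : ∀ {X Y} (x : V X) (y : V Y) →
                mul (R X x) (R Y y) ≈[ X ⊔ˢ Y ]
                R (X ⊔ˢ Y) (Module._+ᴹ_ (obj (X ⊔ˢ Y))
                              (Module._+ᴹ_ (obj (X ⊔ˢ Y)) (mul (R X x) y) (mul x (R Y y)))
                              (Module._*ₗ_ (obj (X ⊔ˢ Y)) λ' (mul x y)))

record IsGradedRotaBaxter {c a ℓa h : Level} {S : Set c} {A : Set a}
         (_≈_ : A → A → Set ℓa) (_+_ : A → A → A) (_∙_ : S → A → A)
         (_·_ : A → A → A) (Homog : ℕ → A → Set h)
         (λ' : S) (Q : A → A) : Set (c ⊔ a ⊔ ℓa ⊔ h) where
  field
    Q-cong  : ∀ x y → x ≈ y → Q x ≈ Q y
    Q-+     : ∀ x y → Q (x + y) ≈ (Q x + Q y)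
    Q-*     : ∀ s x → Q (s ∙ x) ≈ (s ∙ Q x)
    Q-grade : ∀ n x → Homog n x → Homog n (Q x)
    Q-RB    : ∀ x y → (Q x · Q y) ≈ Q (((Q x · y) + (x · Q y)) + (λ' ∙ (x · y)))

module _ {c ℓ : Level} {K : Field c ℓ} {λ' : Field.Carrier K} {m ℓm : Level}
         (RBP : RotaBaxterSpecies K λ' m ℓm) where
  private
    module K = Field K
  open RotaBaxterSpecies RBP
  open Species species
  open TwistedAlgebra twisted

  Vn : ℕ → Set m
  Vn n = Module.Carrierᴹ (obj (n̲ n))

  -- Elements of 𝓕(P) = ⊕ₙ P[n̲], as finite formal sums of homogeneous
  -- elements (compared componentwise below)
  𝓕 : Set m
  𝓕 = List (Σ ℕ Vn)

  comp : (k : ℕ) → 𝓕 → Vn k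
  comp k [] = Module.0ᴹ (obj (n̲ k))
  comp k ((n , x) ∷ xs) with n ≟ k
  ... | yes refl = Module._+ᴹ_ (obj (n̲ k)) x (comp k xs)
  ... | no _     = comp k xs

  _+𝓕_ : 𝓕 → 𝓕 → 𝓕
  _+𝓕_ = _++_

  _∙𝓕_ : K.Carrier → 𝓕 → 𝓕
  a ∙𝓕 xs = map (λ { (n , x) → n , Module._*ₗ_ (obj (n̲ n)) a x }) xs

  homProd : Σ ℕ Vn → Σ ℕ Vn → Σ ℕ Vn
  homProd (p , x) (q , y) = (p + q) , mapˢ (σ p q) (mul x y)

  _·𝓕_ : 𝓕 → 𝓕 → 𝓕
  xs ·𝓕 ys = concatMap (λ u → map (homProd u) ys) xs

  1𝓕 : 𝓕
  1𝓕 = (0 , unit) ∷ []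

  Q𝓕 : 𝓕 → 𝓕
  Q𝓕 = map (λ { (n , x) → n , R (n̲ n) x })

  _≈𝓕_ : 𝓕 → 𝓕 → Set ℓm
  xs ≈𝓕 ys = ∀ k → Module._≈ᴹ_ (obj (n̲ k)) (comp k xs) (comp k ys)

  Homog𝓕 : ℕ → 𝓕 → Set ℓm
  Homog𝓕 n xs = ∀ k → k ≢ n → Module._≈ᴹ_ (obj (n̲ k)) (comp k xs) (Module.0ᴹ (obj (n̲ k)))

  -- Coinvariants: the subspace of P[n̲] spanned by x - P[α](x), α ∈ 𝔖ₙ
  data InSpan (n : ℕ) : Vn n → Set (c ⊔ m ⊔ ℓm) where
    gen   : (α : Bij (n̲ n) (n̲ n)) (x : Vn n)
            → InSpan n (Module._+ᴹ_ (obj (n̲ n)) x (Module.-ᴹ_ (obj (n̲ n)) (mapˢ α x)))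
    zero  : InSpan n (Module.0ᴹ (obj (n̲ n)))
    add   : ∀ {x y} → InSpan n x → InSpan n y → InSpan n (Module._+ᴹ_ (obj (n̲ n)) x y)
    scale : ∀ a {x} → InSpan n x → InSpan n (Module._*ₗ_ (obj (n̲ n)) a x)
    resp  : ∀ {x y} → Module._≈ᴹ_ (obj (n̲ n)) x y → InSpan n x → InSpan n y

  _≈Coinv[_]_ : ∀ {n} → Vn n → (k : ℕ) → Vn n → Set (c ⊔ m ⊔ ℓm)
  _≈Coinv[_]_ {n} x _ y = InSpan n (Module._+ᴹ_ (obj (n̲ n)) x (Module.-ᴹ_ (obj (n̲ n)) y))

  -- equality in 𝓕̄(P) = ⊕ₙ Coinv(P[n̲]) (elements represented by elements of 𝓕(P))
  _≈𝓕̄_ : 𝓕 → 𝓕 → Set (c ⊔ m ⊔ ℓm)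
  xs ≈𝓕̄ ys = ∀ k → comp k xs ≈Coinv[ k ] comp k ys

  Homog𝓕̄ : ℕ → 𝓕 → Set (c ⊔ m ⊔ ℓm)
  Homog𝓕̄ n xs = ∀ k → k ≢ n → comp k xs ≈Coinv[ k ] Module.0ᴹ (obj (n̲ k))

{-# OPTIONS --safe #-}

-- Everything is checked degreewise through the component maps comp k, which are additive and
-- turn Q𝓕 into R. Both sides of the Rota–Baxter identity are bilinear in (x, y), so it reduces
-- to homogeneous x ∈ P[p̲], y ∈ P[q̲], where it is the identity R-RB of the species transported
-- along σ_{p,q} by naturality of R. For 𝓕̄: R sends a generator x − P[α]x of the coinvariant
-- relations to R x − P[α](R x), so Q𝓕 preserves them, and each identity valid in 𝓕 holds in 𝓕̄.

module Submission where

open import Defs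
open import Level using (Level)
open import Data.Product using (_×_; _,_)
open import Data.Nat using (ℕ; _+_; _≟_)
open import Data.List using ([]; _∷_; _++_; map)
open import Data.List.Properties using (map-++)
open import Relation.Binary.Bundles using (Setoid)
open import Relation.Binary.PropositionalEquality using (refl)
import Relation.Binary.Reasoning.Setoid as ≈-Reasoning
open import Relation.Nullary using (yes; no)
open import Algebra.Bundles using (Group; CommutativeRing; CommutativeMonoid)
open import Algebra.Module.Bundles using (Module)
import Algebra.Properties.Group as GroupProperties
import Algebra.Properties.CommutativeSemigroup as CommutativeSemigroupProperties

module _ {a ℓ : Level} (G : Group a ℓ) where
  open Group G
  open GroupProperties G using (identityˡ-unique; inverseˡ-unique)
  open ≈-Reasoning setoid

  module GroupEndomorphism (f : Carrier → Carrier) (f-cong : ∀ {x y} → x ≈ y → f x ≈ f y)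
                           (∙-homo : ∀ x y → f (x ∙ y) ≈ f x ∙ f y) where

    ε-homo : f ε ≈ ε
    ε-homo = identityˡ-unique (f ε) (f ε) (begin
      f ε ∙ f ε  ≈⟨ ∙-homo ε ε ⟨
      f (ε ∙ ε)  ≈⟨ f-cong (identityˡ ε) ⟩
      f ε        ∎)

    ⁻¹-homo : ∀ x → f (x ⁻¹) ≈ f x ⁻¹
    ⁻¹-homo x = inverseˡ-unique (f (x ⁻¹)) (f x) (begin
      f (x ⁻¹) ∙ f x  ≈⟨ ∙-homo (x ⁻¹) x ⟨
      f (x ⁻¹ ∙ x)    ≈⟨ f-cong (inverseˡ x) ⟩
      f ε             ≈⟨ ε-homo ⟩
      ε               ∎)

    difference-homo : ∀ x y → f (x ∙ y ⁻¹) ≈ f x ∙ f y ⁻¹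
    difference-homo x y = trans (∙-homo x (y ⁻¹)) (∙-congˡ (⁻¹-homo y))

module ModuleProperties {r ℓr m ℓm : Level} {CR : CommutativeRing r ℓr} (M : Module CR m ℓm) where
  open Module M
  open CommutativeSemigroupProperties (CommutativeMonoid.commutativeSemigroup +ᴹ-commutativeMonoid)
    using (interchange)
  open ≈-Reasoning ≈ᴹ-setoid

  +ᴹ-*ₗ-interchange : ∀ s a b c a′ b′ c′ →
    ((a +ᴹ b) +ᴹ s *ₗ c) +ᴹ ((a′ +ᴹ b′) +ᴹ s *ₗ c′)
      ≈ᴹ ((a +ᴹ a′) +ᴹ (b +ᴹ b′)) +ᴹ s *ₗ (c +ᴹ c′)
  +ᴹ-*ₗ-interchange s a b c a′ b′ c′ = begin
    ((a +ᴹ b) +ᴹ s *ₗ c) +ᴹ ((a′ +ᴹ b′) +ᴹ s *ₗ c′)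
      ≈⟨ interchange _ _ _ _ ⟩
    ((a +ᴹ b) +ᴹ (a′ +ᴹ b′)) +ᴹ (s *ₗ c +ᴹ s *ₗ c′)
      ≈⟨ +ᴹ-cong (interchange a a′ b b′) (*ₗ-distribˡ s c c′) ⟨
    ((a +ᴹ a′) +ᴹ (b +ᴹ b′)) +ᴹ s *ₗ (c +ᴹ c′) ∎

module _ {c ℓ : Level} {K : Field c ℓ} {λ' : Field.Carrier K} {m ℓm : Level}
         (P : RotaBaxterSpecies K λ' m ℓm) where
  open RotaBaxterSpecies P
  open Species species
  open TwistedAlgebra twisted
  open SpeciesNotation K species using (_≈[_]_)

  private
    module V (k : ℕ) = Module (obj (n̲ k))
    module VP (k : ℕ) = ModuleProperties (obj (n̲ k))
    module R (k : ℕ) = GroupEndomorphism (V.+ᴹ-group k) (R (n̲ k)) (R-cong (n̲ k)) (R-+ (n̲ k))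

    Q : 𝓕 P → 𝓕 P
    Q = Q𝓕 P

    infixl 7 _·_
    _·_ : 𝓕 P → 𝓕 P → 𝓕 P
    _·_ = _·𝓕_ P

    infixr 7 _∙_
    _∙_ : Field.Carrier K → 𝓕 P → 𝓕 P
    _∙_ = _∙𝓕_ P

  ι : ∀ n → Vn P n → 𝓕 P
  ι n x = (n , x) ∷ []

  rbArg : 𝓕 P → 𝓕 P → 𝓕 P → 𝓕 P
  rbArg a b c = (a ++ b) ++ λ' ∙ c

  module Component (k : ℕ) where
    open Module (obj (n̲ k))
    open ≈-Reasoning ≈ᴹ-setoid

    rbArgₙ : Vn P k → Vn P k → Vn P k → Vn P k
    rbArgₙ a b c = (a +ᴹ b) +ᴹ λ' *ₗ c

    comp-++ : ∀ xs ys → comp P k (xs ++ ys) ≈ᴹ comp P k xs +ᴹ comp P k ys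
    comp-++ [] ys = ≈ᴹ-sym (+ᴹ-identityˡ _)
    comp-++ ((n , x) ∷ xs) ys with n ≟ k
    ... | yes refl = ≈ᴹ-trans (+ᴹ-congˡ (comp-++ xs ys)) (≈ᴹ-sym (+ᴹ-assoc _ _ _))
    ... | no _     = comp-++ xs ys

    comp-∙ : ∀ s xs → comp P k (s ∙ xs) ≈ᴹ s *ₗ comp P k xs
    comp-∙ s [] = ≈ᴹ-sym (*ₗ-zeroʳ s)
    comp-∙ s ((n , x) ∷ xs) with n ≟ k
    ... | yes refl = ≈ᴹ-trans (+ᴹ-congˡ (comp-∙ s xs)) (≈ᴹ-sym (*ₗ-distribˡ s _ _))
    ... | no _     = comp-∙ s xs

    comp-Q : ∀ xs → comp P k (Q xs) ≈ᴹ R (n̲ k) (comp P k xs)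
    comp-Q [] = ≈ᴹ-sym (R.ε-homo k)
    comp-Q ((n , x) ∷ xs) with n ≟ k
    ... | yes refl = ≈ᴹ-trans (+ᴹ-congˡ (comp-Q xs)) (≈ᴹ-sym (R-+ (n̲ k) _ _))
    ... | no _     = comp-Q xs

    comp-rbArg : ∀ a b c → comp P k (rbArg a b c) ≈ᴹ rbArgₙ (comp P k a) (comp P k b) (comp P k c)
    comp-rbArg a b c = begin
      comp P k ((a ++ b) ++ λ' ∙ c)                    ≈⟨ comp-++ (a ++ b) (λ' ∙ c) ⟩
      comp P k (a ++ b) +ᴹ comp P k (λ' ∙ c)           ≈⟨ +ᴹ-cong (comp-++ a b) (comp-∙ λ' c) ⟩
      (comp P k a +ᴹ comp P k b) +ᴹ λ' *ₗ comp P k c  ∎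

    comp-ι-cong : ∀ n {x y} → x ≈[ n̲ n ] y → comp P k (ι n x) ≈ᴹ comp P k (ι n y)
    comp-ι-cong n x≈y with n ≟ k
    ... | yes refl = +ᴹ-congʳ x≈y
    ... | no _     = ≈ᴹ-refl

    comp-ι-+ : ∀ n x y → comp P k (ι n (V._+ᴹ_ n x y)) ≈ᴹ comp P k (ι n x) +ᴹ comp P k (ι n y)
    comp-ι-+ n x y with n ≟ k
    ... | yes refl = begin
      (x +ᴹ y) +ᴹ 0ᴹ          ≈⟨ +ᴹ-identityʳ _ ⟩
      x +ᴹ y                  ≈⟨ +ᴹ-cong (+ᴹ-identityʳ x) (+ᴹ-identityʳ y) ⟨
      (x +ᴹ 0ᴹ) +ᴹ (y +ᴹ 0ᴹ)  ∎
    ... | no _     = ≈ᴹ-sym (+ᴹ-identityˡ 0ᴹ)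

  open Component

  𝓕-setoid : Setoid m ℓm
  𝓕-setoid = record
    { Carrier       = 𝓕 P
    ; _≈_           = _≈𝓕_ P
    ; isEquivalence = record
      { refl  = λ k → V.≈ᴹ-refl k
      ; sym   = λ x≈y k → V.≈ᴹ-sym k (x≈y k)
      ; trans = λ x≈y y≈z k → V.≈ᴹ-trans k (x≈y k) (y≈z k)
      }
    }

  open Setoid 𝓕-setoid using (_≈_; reflexive)

  ++-cong : ∀ xs xs′ ys ys′ → xs ≈ xs′ → ys ≈ ys′ → xs ++ ys ≈ xs′ ++ ys′
  ++-cong xs xs′ ys ys′ xs≈xs′ ys≈ys′ k = begin
    comp P k (xs ++ ys)           ≈⟨ comp-++ k xs ys ⟩
    comp P k xs +ᴹ comp P k ys    ≈⟨ +ᴹ-cong (xs≈xs′ k) (ys≈ys′ k) ⟩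
    comp P k xs′ +ᴹ comp P k ys′  ≈⟨ comp-++ k xs′ ys′ ⟨
    comp P k (xs′ ++ ys′)         ∎
    where open V k
          open ≈-Reasoning ≈ᴹ-setoid

  ι-cong : ∀ n {x y} → x ≈[ n̲ n ] y → ι n x ≈ ι n y
  ι-cong n x≈y k = comp-ι-cong k n x≈y

  ι-+ : ∀ n x y → ι n (V._+ᴹ_ n x y) ≈ ι n x ++ ι n y
  ι-+ n x y k = V.≈ᴹ-trans k (comp-ι-+ k n x y) (V.≈ᴹ-sym k (comp-++ k (ι n x) (ι n y)))

  Q-cong : ∀ xs ys → xs ≈ ys → Q xs ≈ Q ys
  Q-cong xs ys xs≈ys k =
    V.≈ᴹ-trans k (comp-Q k xs) (V.≈ᴹ-trans k (R-cong (n̲ k) (xs≈ys k)) (V.≈ᴹ-sym k (comp-Q k ys)))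

  Q-++ : ∀ xs ys → Q (xs ++ ys) ≈ Q xs ++ Q ys
  Q-++ xs ys = reflexive (map-++ _ xs ys)

  Q-∙ : ∀ s xs → Q (s ∙ xs) ≈ s ∙ Q xs
  Q-∙ s xs k = begin
    comp P k (Q (s ∙ xs))        ≈⟨ comp-Q k (s ∙ xs) ⟩
    R (n̲ k) (comp P k (s ∙ xs))  ≈⟨ R-cong (n̲ k) (comp-∙ k s xs) ⟩
    R (n̲ k) (s *ₗ comp P k xs)   ≈⟨ R-* (n̲ k) s _ ⟩
    s *ₗ R (n̲ k) (comp P k xs)   ≈⟨ *ₗ-congˡ (comp-Q k xs) ⟨
    s *ₗ comp P k (Q xs)         ≈⟨ comp-∙ k s (Q xs) ⟨
    comp P k (s ∙ Q xs)          ∎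
    where open V k
          open ≈-Reasoning ≈ᴹ-setoid

  Q-homogeneous : ∀ n xs → Homog𝓕 P n xs → Homog𝓕 P n (Q xs)
  Q-homogeneous n xs xs∈𝓕ₙ k k≢n =
    V.≈ᴹ-trans k (comp-Q k xs) (V.≈ᴹ-trans k (R-cong (n̲ k) (xs∈𝓕ₙ k k≢n)) (R.ε-homo k))

  rbArg-++ : ∀ a b c a′ b′ c′ → rbArg a b c ++ rbArg a′ b′ c′ ≈ rbArg (a ++ a′) (b ++ b′) (c ++ c′)
  rbArg-++ a b c a′ b′ c′ k = begin
    comp P k (rbArg a b c ++ rbArg a′ b′ c′)
      ≈⟨ comp-++ k (rbArg a b c) (rbArg a′ b′ c′) ⟩
    comp P k (rbArg a b c) +ᴹ comp P k (rbArg a′ b′ c′)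
      ≈⟨ +ᴹ-cong (comp-rbArg k a b c) (comp-rbArg k a′ b′ c′) ⟩
    ((A +ᴹ B) +ᴹ λ' *ₗ C) +ᴹ ((A′ +ᴹ B′) +ᴹ λ' *ₗ C′)
      ≈⟨ VP.+ᴹ-*ₗ-interchange k λ' A B C A′ B′ C′ ⟩
    ((A +ᴹ A′) +ᴹ (B +ᴹ B′)) +ᴹ λ' *ₗ (C +ᴹ C′)
      ≈⟨ +ᴹ-cong (+ᴹ-cong (comp-++ k a a′) (comp-++ k b b′)) (*ₗ-congˡ (comp-++ k c c′)) ⟨
    (comp P k (a ++ a′) +ᴹ comp P k (b ++ b′)) +ᴹ λ' *ₗ comp P k (c ++ c′)
      ≈⟨ comp-rbArg k (a ++ a′) (b ++ b′) (c ++ c′) ⟨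
    comp P k (rbArg (a ++ a′) (b ++ b′) (c ++ c′)) ∎
    where open V k
          open ≈-Reasoning ≈ᴹ-setoid
          A = comp P k a; B = comp P k b; C = comp P k c
          A′ = comp P k a′; B′ = comp P k b′; C′ = comp P k c′

  -- A record rather than a bare ≈ so that the four lists can be inferred from the type.
  record RBImage (x a b c : 𝓕 P) : Set ℓm where
    constructor rbImage
    field
      ≈Q-rbArg : x ≈ Q (rbArg a b c)

  RBImage-[] : RBImage [] [] [] []
  RBImage-[] = rbImage (λ k → V.≈ᴹ-refl k)

  RBImage-++ : ∀ {x a b c x′ a′ b′ c′} → RBImage x a b c → RBImage x′ a′ b′ c′ →
               RBImage (x ++ x′) (a ++ a′) (b ++ b′) (c ++ c′)
  RBImage-++ {x} {a} {b} {c} {x′} {a′} {b′} {c′} (rbImage x≈) (rbImage x′≈) = rbImage (begin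
    x ++ x′
      ≈⟨ ++-cong x (Q (rbArg a b c)) x′ (Q (rbArg a′ b′ c′)) x≈ x′≈ ⟩
    Q (rbArg a b c) ++ Q (rbArg a′ b′ c′)
      ≈⟨ Q-++ (rbArg a b c) (rbArg a′ b′ c′) ⟨
    Q (rbArg a b c ++ rbArg a′ b′ c′)
      ≈⟨ Q-cong (rbArg a b c ++ rbArg a′ b′ c′) (rbArg (a ++ a′) (b ++ b′) (c ++ c′))
                (rbArg-++ a b c a′ b′ c′) ⟩
    Q (rbArg (a ++ a′) (b ++ b′) (c ++ c′)) ∎)
    where open ≈-Reasoning 𝓕-setoid

  ι-RBImage : ∀ n {x y z w} → x ≈[ n̲ n ] R (n̲ n) (rbArgₙ n y z w) →
              RBImage (ι n x) (ι n y) (ι n z) (ι n w)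
  ι-RBImage n {x} {y} {z} {w} x≈ = rbImage (begin
    ι n x                              ≈⟨ ι-cong n x≈ ⟩
    Q (ι n (rbArgₙ n y z w))           ≈⟨ Q-cong (ι n (rbArgₙ n y z w)) (rbArg ιy ιz ιw) ι-rbArgₙ ⟩
    Q (rbArg ιy ιz ιw)                 ∎)
    where
      open ≈-Reasoning 𝓕-setoid
      ιy = ι n y; ιz = ι n z; ιw = ι n w
      y+z = V._+ᴹ_ n y z
      λw = V._*ₗ_ n λ' w
      ι-rbArgₙ : ι n (rbArgₙ n y z w) ≈ rbArg ιy ιz ιw
      ι-rbArgₙ = begin
        ι n (rbArgₙ n y z w)     ≈⟨ ι-+ n y+z λw ⟩
        ι n y+z ++ ι n λw        ≈⟨ ++-cong (ι n y+z) (ιy ++ ιz) (ι n λw) (λ' ∙ ιw) (ι-+ n y z) (λ k → V.≈ᴹ-refl k) ⟩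
        rbArg ιy ιz ιw           ∎

  homProd-RBImage : ∀ p q (a : Vn P p) (b : Vn P q) →
    RBImage (homProd P (p , R (n̲ p) a) (q , R (n̲ q) b) ∷ [])
            (homProd P (p , R (n̲ p) a) (q , b) ∷ [])
            (homProd P (p , a) (q , R (n̲ q) b) ∷ [])
            (homProd P (p , a) (q , b) ∷ [])
  homProd-RBImage p q a b = ι-RBImage (p + q) (begin
    σ* (mul Ra Rb)                           ≈⟨ mapˢ-cong (σ p q) (R-RB a b) ⟩
    σ* (R _ s)                               ≈⟨ R-natural (σ p q) s ⟨
    R _ (σ* s)                               ≈⟨ R-cong _ σ*-s ⟩
    R _ (rbArgₙ (p + q) (σ* (mul Ra b)) (σ* (mul a Rb)) (σ* (mul a b))) ∎)
    where
      open V (p + q)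
      open ≈-Reasoning ≈ᴹ-setoid
      module W = Module (obj (n̲ p ⊔ˢ n̲ q))
      σ* = mapˢ (σ p q)
      Ra = R (n̲ p) a
      Rb = R (n̲ q) b
      s = (mul Ra b W.+ᴹ mul a Rb) W.+ᴹ λ' W.*ₗ mul a b
      σ*-s : σ* s ≈ᴹ rbArgₙ (p + q) (σ* (mul Ra b)) (σ* (mul a Rb)) (σ* (mul a b))
      σ*-s = ≈ᴹ-trans (mapˢ-+ (σ p q) _ _) (+ᴹ-cong (mapˢ-+ (σ p q) _ _) (mapˢ-* (σ p q) λ' _))

  map-homProd-RBImage : ∀ p (a : Vn P p) ys →
    RBImage (map (homProd P (p , R (n̲ p) a)) (Q ys))
            (map (homProd P (p , R (n̲ p) a)) ys)
            (map (homProd P (p , a)) (Q ys))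
            (map (homProd P (p , a)) ys)
  map-homProd-RBImage p a []             = RBImage-[]
  map-homProd-RBImage p a ((q , b) ∷ ys) = RBImage-++ (homProd-RBImage p q a b) (map-homProd-RBImage p a ys)

  ·-RBImage : ∀ xs ys → RBImage (Q xs · Q ys) (Q xs · ys) (xs · Q ys) (xs · ys)
  ·-RBImage []             ys = RBImage-[]
  ·-RBImage ((p , a) ∷ xs) ys = RBImage-++ (map-homProd-RBImage p a ys) (·-RBImage xs ys)

  𝓕-isGradedRotaBaxter : IsGradedRotaBaxter (_≈𝓕_ P) (_+𝓕_ P) (_∙𝓕_ P) (_·𝓕_ P) (Homog𝓕 P) λ' (Q𝓕 P)
  𝓕-isGradedRotaBaxter = record
    { Q-cong  = Q-cong
    ; Q-+     = Q-++
    ; Q-*     = Q-∙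
    ; Q-grade = Q-homogeneous
    ; Q-RB    = λ xs ys → RBImage.≈Q-rbArg (·-RBImage xs ys)
    }

  ≈ᴹ⇒≈Coinv : ∀ k {x y} → x ≈[ n̲ k ] y → _≈Coinv[_]_ P x k y
  ≈ᴹ⇒≈Coinv k x≈y = InSpan.resp (V.≈ᴹ-sym k (x≈y⇒x∙y⁻¹≈ε x≈y)) InSpan.zero
    where open GroupProperties (V.+ᴹ-group k) using (x≈y⇒x∙y⁻¹≈ε)

  R-InSpan : ∀ {k x} → InSpan P k x → InSpan P k (R (n̲ k) x)
  R-InSpan {k} (InSpan.gen α x) = InSpan.resp R-gen (InSpan.gen α (R (n̲ k) x))
    where
      open V k
      R-gen : R (n̲ k) x +ᴹ -ᴹ mapˢ α (R (n̲ k) x) ≈ᴹ R (n̲ k) (x +ᴹ -ᴹ mapˢ α x)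
      R-gen = ≈ᴹ-sym (≈ᴹ-trans (R.difference-homo k x (mapˢ α x)) (+ᴹ-congˡ (-ᴹ‿cong (R-natural α x))))
  R-InSpan {k} InSpan.zero          = InSpan.resp (V.≈ᴹ-sym k (R.ε-homo k)) InSpan.zero
  R-InSpan {k} (InSpan.add x∈ y∈)   = InSpan.resp (V.≈ᴹ-sym k (R-+ (n̲ k) _ _)) (InSpan.add (R-InSpan x∈) (R-InSpan y∈))
  R-InSpan {k} (InSpan.scale s x∈)  = InSpan.resp (V.≈ᴹ-sym k (R-* (n̲ k) s _)) (InSpan.scale s (R-InSpan x∈))
  R-InSpan {k} (InSpan.resp x≈y x∈) = InSpan.resp (R-cong (n̲ k) x≈y) (R-InSpan x∈)

  comp-Q-resp-≈Coinv : ∀ k xs ys → _≈Coinv[_]_ P (comp P k xs) k (comp P k ys) →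
                       _≈Coinv[_]_ P (comp P k (Q xs)) k (comp P k (Q ys))
  comp-Q-resp-≈Coinv k xs ys xs≈ys = InSpan.resp R-difference (R-InSpan xs≈ys)
    where
      open V k
      R-difference : R (n̲ k) (comp P k xs +ᴹ -ᴹ comp P k ys) ≈ᴹ comp P k (Q xs) +ᴹ -ᴹ comp P k (Q ys)
      R-difference = ≈ᴹ-trans (R.difference-homo k _ _)
                              (+ᴹ-cong (≈ᴹ-sym (comp-Q k xs)) (-ᴹ‿cong (≈ᴹ-sym (comp-Q k ys))))

  𝓕̄-isGradedRotaBaxter : IsGradedRotaBaxter (_≈𝓕̄_ P) (_+𝓕_ P) (_∙𝓕_ P) (_·𝓕_ P) (Homog𝓕̄ P) λ' (Q𝓕 P)
  𝓕̄-isGradedRotaBaxter = record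
    { Q-cong  = λ xs ys xs≈ys k → comp-Q-resp-≈Coinv k xs ys (xs≈ys k)
    ; Q-+     = λ xs ys k → ≈ᴹ⇒≈Coinv k (Q-++ xs ys k)
    ; Q-*     = λ s xs k → ≈ᴹ⇒≈Coinv k (Q-∙ s xs k)
    ; Q-grade = λ n xs xs∈𝓕̄ₙ k k≢n → comp-Q-resp-≈Coinv k xs [] (xs∈𝓕̄ₙ k k≢n)
    ; Q-RB    = λ xs ys k → ≈ᴹ⇒≈Coinv k (RBImage.≈Q-rbArg (·-RBImage xs ys) k)
    }

lemma4p4 : {c ℓ : Level} (K : Field c ℓ) (λ' : Field.Carrier K) {m ℓm : Level}
           (P : RotaBaxterSpecies K λ' m ℓm) →
           IsGradedRotaBaxter (_≈𝓕_ P) (_+𝓕_ P) (_∙𝓕_ P) (_·𝓕_ P) (Homog𝓕 P) λ' (Q𝓕 P)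
           × IsGradedRotaBaxter (_≈𝓕̄_ P) (_+𝓕_ P) (_∙𝓕_ P) (_·𝓕_ P) (Homog𝓕̄ P) λ' (Q𝓕 P)
lemma4p4 K λ' P = 𝓕-isGradedRotaBaxter P , 𝓕̄-isGradedRotaBaxter P
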